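{- Let $(G,Z)$ be a monic plantation. Then there exist $X\subseteq Z$ and $Y\subseteq V(G)\setminus Z$ with $|X|<s$ and $|Y|<2s\cdot s!$ such that exploding the vertices in $X$ and deleting the vertices in $Y$ yields a selfless plantation.
   Context: Fix an integer $s\ge1$. Graphs are finite and simple. Two vertex sets are anticomplete if they are disjoint with no edges between them (subgraphs are anticomplete if their vertex sets are). A graph is $s\mathcal{O}$-free if no $s$ cycles of it are pairwise vertex-disjoint and pairwise anticomplete. $Z\subseteq V(G)$ is cycle-hitting if every cycle of $G$ meets $Z$. A plantation is a pair $(G,Z)$ with $G$ an $s\mathcal{O}$-free graph and $Z\subseteq V(G)$ cycle-hitting; let $F=G\setminus Z$ (a forest) and $N$ the set of vertices in $V(G)\setminus Z$ with a neighbour in $Z$. $(G,Z)$ is monic if $Z$ is stable and each vertex of $N$ has a unique neighbour in $Z$. A transition is a path of $F$ with at least one edge, both ends in $N$, and no internal vertex in $N$; a foot of a transition $P$ is a vertex of $Z$ adjacent to an end of $P$. A self-transition is a transition with only one foot; $(G,Z)$ is selfless if it has no self-transition. Deleting $v\in V(G)\setminus Z$ produces the plantation $(G\setminus\{v\},Z)$. Exploding $z\in Z$ produces the plantation $(G',Z\setminus\{z\})$, where $G'$ is obtained from $G$ by deleting $z$ and all its neighbours in $V(G)\setminus Z$. -}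

module Defs where

open import Level using (0ℓ)
open import Data.Nat using (ℕ; _≤_; _<_; _*_; _!; suc)
open import Data.Bool using (Bool; true; false; T)
open import Data.Fin using (Fin)
open import Data.Fin.Subset using (Subset; _∈_; _∉_)
open import Data.List using (List; []; _∷_; _++_; [_]; length)
open import Data.List.Membership.Propositional using () renaming (_∈_ to _∈ₗ_)
open import Data.List.Relation.Unary.All using (All)
open import Data.List.Relation.Unary.Any using (Any)
open import Data.List.Relation.Unary.AllPairs using (AllPairs)
open import Data.List.Relation.Unary.Linked using (Linked)
open import Data.List.Relation.Unary.Unique.Propositional using (Unique)
open import Data.Product using (Σ; ∃; ∃-syntax; _×_)
open import Data.Sum using (_⊎_)
open import Data.Empty using (⊥)
open import Relation.Nullary using (¬_)
open import Relation.Binary.PropositionalEquality using (_≡_; _≢_)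

record Graph (n : ℕ) : Set where
  field
    adj    : Fin n → Fin n → Bool
    sym    : ∀ u v → adj u v ≡ adj v u
    irrefl : ∀ v → adj v v ≡ false

module _ {n : ℕ} (G : Graph n) where
  Adj : Fin n → Fin n → Set
  Adj u v = T (Graph.adj G u v)

  -- Everything below speaks about the induced subgraph G[W] (W a vertex
  -- predicate) together with a set Z of "special" vertices (predicate).

  IsCycle : (W : Fin n → Set) → List (Fin n) → Set
  IsCycle W []       = ⊥
  IsCycle W (v ∷ vs) =
    3 ≤ length (v ∷ vs) × Unique (v ∷ vs) ×
    Linked Adj ((v ∷ vs) ++ [ v ]) × All W (v ∷ vs)

  Anticomplete : List (Fin n) → List (Fin n) → Set
  Anticomplete A B = ∀ {a b} → a ∈ₗ A → b ∈ₗ B → (a ≢ b) × ¬ Adj a b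

  SOFree : ℕ → (W : Fin n → Set) → Set
  SOFree s W = ¬ (Σ (List (List (Fin n))) λ cs →
                   length cs ≡ s × All (IsCycle W) cs × AllPairs Anticomplete cs)

  CycleHitting : (W Z : Fin n → Set) → Set
  CycleHitting W Z = ∀ vs → IsCycle W vs → Any Z vs

  Plantation : ℕ → (W Z : Fin n → Set) → Set
  Plantation s W Z = SOFree s W × (∀ v → Z v → W v) × CycleHitting W Z

  InN : (W Z : Fin n → Set) → Fin n → Set
  InN W Z v = W v × ¬ Z v × ∃[ z ] (Z z × Adj v z)

  IsTransition : (W Z : Fin n → Set) → Fin n → List (Fin n) → Fin n → Set
  IsTransition W Z a mid b =
    Unique (a ∷ mid ++ [ b ]) ×
    Linked Adj (a ∷ mid ++ [ b ]) ×
    All (λ v → W v × ¬ Z v) (a ∷ mid ++ [ b ]) ×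
    InN W Z a × InN W Z b ×
    All (λ v → ¬ InN W Z v) mid

  IsFoot : (W Z : Fin n → Set) → Fin n → Fin n → Fin n → Set
  IsFoot W Z a b z = Z z × (Adj a z ⊎ Adj b z)

  IsSelfTransition : (W Z : Fin n → Set) → Fin n → List (Fin n) → Fin n → Set
  IsSelfTransition W Z a mid b =
    IsTransition W Z a mid b ×
    ∃[ z ] (IsFoot W Z a b z × (∀ z' → IsFoot W Z a b z' → z' ≡ z))

  Selfless : (W Z : Fin n → Set) → Set
  Selfless W Z = ¬ (∃[ a ] ∃[ mid ] ∃[ b ] IsSelfTransition W Z a mid b)

  Monic : Subset n → Set
  Monic Z = (∀ u v → u ∈ Z → v ∈ Z → ¬ Adj u v) ×
            (∀ v z z' → v ∉ Z → z ∈ Z → z' ∈ Z → Adj v z → Adj v z' → z ≡ z')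

  -- Vertex set after exploding X ⊆ Z and deleting Y ⊆ V(G) \ Z
  AfterOps : (Z X Y : Subset n) → Fin n → Set
  AfterOps Z X Y v = v ∉ X × (v ∉ Z → ∀ x → x ∈ X → ¬ Adj v x) × v ∉ Y

  ZAfter : (Z X : Subset n) → Fin n → Set
  ZAfter Z X v = v ∈ Z × v ∉ X

{-# OPTIONS --safe #-}
-- Since Z hits every cycle, F = G \ Z is a forest; root it by a ranking in which every vertex has at most
-- one neighbour of higher rank, its parent. A path of F rises to its highest vertex, its top, and then
-- falls, so every vertex of the path climbs to the top by following parents. A self-transition closed up
-- by its unique foot is a cycle of G, and (Z being stable) two self-transitions with distinct feet and
-- anticomplete paths give anticomplete cycles. Now repeatedly pick a self-transition P of least top rank,
-- explode its foot and delete its top t together with the parent of t. A later self-transition Q touching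
-- P either contains that parent, or climbs from the touching vertex to t; as climbs are unique and the top
-- of Q is at least as high as t, Q then contains t. So the picked self-transitions are pairwise compatible,
-- fewer than s of them are picked, and ∣ X ∣ < s, ∣ Y ∣ ≤ 2 ∣ X ∣ < 2 s.

module Submission where

open import Defs
open import Data.Bool using (T)
open import Data.Empty using (⊥; ⊥-elim)
open import Data.Fin using (Fin; zero; suc; _≟_)
open import Data.Fin.Properties using (pigeonhole; any?; all?) renaming (<⇒≢ to <⇒≢ᶠ)
open import Data.Fin.Subset using (Subset; _∈_; _∉_; _⊆_; ∁; ∣_∣; ⁅_⁆; _∪_; ⋃; inside; outside)
open import Data.Fin.Subset.Properties
  using (_∈?_; x∈p∪q⁻; x∈p∪q⁺; ∉⊥; ∣⊥∣≡0; x∈⁅x⁆; x∈⁅y⁆⇒x≡y; ∣⁅x⁆∣≡1; x∉p⇒x∈∁p; x∈∁p⇒x∉p)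
open import Data.Vec using ([]; _∷_)
open import Data.List using (List; []; _∷_; _++_; [_]; length; lookup; map; cartesianProduct; filter; allFin)
open import Data.List.Properties using (length-++; length-map; filter-notAll)
open import Data.List.Extrema.Nat
  using (argmin; argmin-all; f[argmin]≤f[⊤]; f[argmin]≤f[xs]; argmax; argmax-all; f[⊥]≤f[argmax]; f[xs]≤f[argmax])
open import Data.List.Membership.Propositional using (find; lose) renaming (_∈_ to _∈ₗ_)
open import Data.List.Membership.Propositional.Properties
  using (∈-lookup; ∈-map⁺; ∈-cartesianProduct⁺; ∈-filter⁺; ∈-filter⁻; ∈-∃++; ∈-allFin; ∈-++⁻; ∈-++⁺ˡ; ∈-++⁺ʳ)
open import Data.List.Relation.Unary.All as All using (All; []; _∷_)
open import Data.List.Relation.Unary.All.Properties as All using (¬Any⇒All¬; All¬⇒¬Any)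
open import Data.List.Relation.Unary.AllPairs as AllPairs using (AllPairs; []; _∷_)
open import Data.List.Relation.Unary.AllPairs.Properties as AllPairs using ()
open import Data.List.Relation.Unary.Any as Any using (Any; here; there)
open import Data.List.Relation.Unary.Any.Properties as Any using ()
open import Data.List.Relation.Unary.Linked as Linked using (Linked; []; [-]; _∷_)
open import Data.List.Relation.Unary.Unique.Propositional using (Unique)
open import Data.Nat using (ℕ; zero; suc; _+_; _*_; _≤_; _<_; z≤n; s≤s; _≤?_; _!)
open import Data.Nat.Properties
  using ( ≤-refl; ≤-reflexive; ≤-trans; ≤-pred; <⇒≤; <-trans; <-≤-trans; ≤-<-trans; <-irrefl; <⇒≱; ≰⇒>
        ; ≤∧≢⇒<; <⇒≤pred; <-cmp; _<?_; n≮0; 0≢1+n; suc-injective; n≤1+n; m≤m+n; m≤n+m; +-suc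
        ; +-monoʳ-≤; +-mono-≤; *-suc; *-identityˡ; *-monoʳ-<; m≤m*n; _!≢0; module ≤-Reasoning)
open import Data.Product using (∃; ∃-syntax; _×_; _,_; proj₁; proj₂; uncurry)
open import Data.Sum as Sum using (_⊎_; inj₁; inj₂; [_,_]′)
open import Data.Unit using (⊤; tt)
open import Function using (_∘_)
open import Relation.Nullary using (¬_; Dec; yes; no; ¬?; contradiction)
open import Relation.Nullary.Decidable using (_×-dec_; _⊎-dec_; _→-dec_; decidable-stable; T?)
open import Relation.Binary.Definitions using (tri<; tri≈; tri>)
open import Relation.Binary.PropositionalEquality using (_≡_; _≢_; refl; sym; trans; cong; cong₂; subst; subst₂)

lookup-injective : ∀ {A : Set} (xs : List A) → Unique xs →
                   ∀ i j → lookup xs i ≡ lookup xs j → i ≡ j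
lookup-injective (_ ∷ _)  _               zero    zero    _  = refl
lookup-injective (_ ∷ xs) (x∉xs ∷ _)      zero    (suc j) eq = ⊥-elim (All.lookup x∉xs (∈-lookup j) eq)
lookup-injective (_ ∷ xs) (x∉xs ∷ _)      (suc i) zero    eq = ⊥-elim (All.lookup x∉xs (∈-lookup i) (sym eq))
lookup-injective (_ ∷ xs) (_ ∷ unique-xs) (suc i) (suc j) eq = cong suc (lookup-injective xs unique-xs i j eq)

Unique⇒length≤ : ∀ {n} {xs : List (Fin n)} → Unique xs → length xs ≤ n
Unique⇒length≤ {n} {xs} unique with length xs ≤? n
... | yes ≤n = ≤n
... | no ≰n =
  let i , j , i<j , eq = pigeonhole (≰⇒> ≰n) (lookup xs)
  in  contradiction (lookup-injective xs unique i j eq) (<⇒≢ᶠ i<j)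

removing-member-shortens : ∀ {n} {v : Fin n} {xs} → v ∈ₗ xs → length (filter (¬? ∘ (_≟ v)) xs) < length xs
removing-member-shortens {xs = xs} v∈ = filter-notAll (¬? ∘ (_≟ _)) xs (Any.map (λ v≡u u≢v → u≢v (sym v≡u)) v∈)

module _ {A : Set} where

  All-prefix : ∀ {P : A → Set} xs {c ys} → All P (xs ++ c ∷ ys) → All P (xs ++ [ c ])
  All-prefix []       (pc ∷ _)   = pc ∷ []
  All-prefix (_ ∷ xs) (px ∷ pxs) = px ∷ All-prefix xs pxs

  AllPairs-prefix : ∀ {R : A → A → Set} xs {c ys} → AllPairs R (xs ++ c ∷ ys) → AllPairs R (xs ++ [ c ])
  AllPairs-prefix []       (_ ∷ _)    = [] ∷ []
  AllPairs-prefix (_ ∷ xs) (rx ∷ rxs) = All-prefix xs rx ∷ AllPairs-prefix xs rxs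

  Linked-prefix : ∀ {R : A → A → Set} xs {c ys} → Linked R (xs ++ c ∷ ys) → Linked R (xs ++ [ c ])
  Linked-prefix []           _          = [-]
  Linked-prefix (_ ∷ [])     (r ∷ _)    = r ∷ [-]
  Linked-prefix (_ ∷ x ∷ xs) (r ∷ rxs) = r ∷ Linked-prefix (x ∷ xs) rxs

  Linked-snoc : ∀ {R : A → A → Set} xs {c d} → Linked R (xs ++ [ c ]) → R c d → Linked R ((xs ++ [ c ]) ++ [ d ])
  Linked-snoc []           _         r = r ∷ [-]
  Linked-snoc (_ ∷ [])     (r′ ∷ _)  r = r′ ∷ r ∷ [-]
  Linked-snoc (_ ∷ x ∷ xs) (r′ ∷ rs) r = r′ ∷ Linked-snoc (x ∷ xs) rs r

  boundedLists : List A → ℕ → List (List A)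
  boundedLists as zero    = [ [] ]
  boundedLists as (suc k) = [] ∷ map (uncurry _∷_) (cartesianProduct as (boundedLists as k))

  ∈-boundedLists : ∀ {as xs} k → All (_∈ₗ as) xs → length xs ≤ k → xs ∈ₗ boundedLists as k
  ∈-boundedLists {xs = []}     zero    _           _         = here refl
  ∈-boundedLists {xs = []}     (suc k) _           _         = here refl
  ∈-boundedLists {xs = x ∷ xs} (suc k) (x∈ ∷ xs∈) (s≤s len) =
    there (∈-map⁺ (uncurry _∷_) (∈-cartesianProduct⁺ x∈ (∈-boundedLists k xs∈ len)))

∣p∪q∣≤∣p∣+∣q∣ : ∀ {n} (p q : Subset n) → ∣ p ∪ q ∣ ≤ ∣ p ∣ + ∣ q ∣
∣p∪q∣≤∣p∣+∣q∣ []            []            = z≤n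
∣p∪q∣≤∣p∣+∣q∣ (inside  ∷ p) (inside  ∷ q) = s≤s (≤-trans (∣p∪q∣≤∣p∣+∣q∣ p q) (+-monoʳ-≤ ∣ p ∣ (n≤1+n ∣ q ∣)))
∣p∪q∣≤∣p∣+∣q∣ (inside  ∷ p) (outside ∷ q) = s≤s (∣p∪q∣≤∣p∣+∣q∣ p q)
∣p∪q∣≤∣p∣+∣q∣ (outside ∷ p) (inside  ∷ q) = ≤-trans (s≤s (∣p∪q∣≤∣p∣+∣q∣ p q)) (≤-reflexive (sym (+-suc ∣ p ∣ ∣ q ∣)))
∣p∪q∣≤∣p∣+∣q∣ (outside ∷ p) (outside ∷ q) = ∣p∪q∣≤∣p∣+∣q∣ p q

module _ {n : ℕ} where

  x∈⋃⁺ : ∀ {x : Fin n} ps → Any (x ∈_) ps → x ∈ ⋃ ps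
  x∈⋃⁺ (p ∷ ps) (here x∈p)   = x∈p∪q⁺ (inj₁ x∈p)
  x∈⋃⁺ (p ∷ ps) (there x∈ps) = x∈p∪q⁺ (inj₂ (x∈⋃⁺ ps x∈ps))

  x∈⋃⁻ : ∀ {x : Fin n} ps → x ∈ ⋃ ps → Any (x ∈_) ps
  x∈⋃⁻ []       x∈ = ⊥-elim (∉⊥ x∈)
  x∈⋃⁻ (p ∷ ps) x∈ = [ here , (λ x∈⋃ps → there (x∈⋃⁻ ps x∈⋃ps)) ]′ (x∈p∪q⁻ p (⋃ ps) x∈)

  ∣⋃∣≤ : ∀ {c} (ps : List (Subset n)) → All (λ p → ∣ p ∣ ≤ c) ps → ∣ ⋃ ps ∣ ≤ c * length ps
  ∣⋃∣≤ {c} []       []             = ≤-trans (≤-reflexive (∣⊥∣≡0 n)) z≤n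
  ∣⋃∣≤ {c} (p ∷ ps) (∣p∣≤c ∷ ∣ps∣≤c) = begin
    ∣ p ∪ ⋃ ps ∣        ≤⟨ ∣p∪q∣≤∣p∣+∣q∣ p (⋃ ps) ⟩
    ∣ p ∣ + ∣ ⋃ ps ∣    ≤⟨ +-mono-≤ ∣p∣≤c (∣⋃∣≤ ps ∣ps∣≤c) ⟩
    c + c * length ps  ≡⟨ sym (*-suc c (length ps)) ⟩
    c * suc (length ps) ∎
    where open ≤-Reasoning

module GreedyCover {S : Set} (key : S → ℕ) (Compatible Hits : S → S → Set)
                   (hits? : ∀ P Q → Dec (Hits P Q))
                   (compatible-unless-hit : ∀ {P Q} → key P ≤ key Q → ¬ Hits P Q → Compatible P Q) where

  Packing : ℕ → List S → Set
  Packing k L = ∃[ Ms ] length Ms ≡ k × All (_∈ₗ L) Ms × AllPairs Compatible Ms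

  HitBy : List S → S → Set
  HitBy Ps Q = Any (λ P → Hits P Q) Ps

  greedy-cover : ∀ k L → ¬ Packing k L → ∃[ Ps ] length Ps < k × All (HitBy Ps) L
  greedy-cover zero    L           no-packing = ⊥-elim (no-packing ([] , refl , [] , []))
  greedy-cover (suc k) []          _          = [] , s≤s z≤n , []
  greedy-cover (suc k) L@(Q₀ ∷ Qs) no-packing =
    let Ps , |Ps|<k , Ps-hit = greedy-cover k Unhit no-packing-of-unhit
    in  P ∷ Ps , s≤s |Ps|<k , All.tabulate (hit Ps-hit)
    where
    P : S
    P = argmin key Q₀ Qs

    P∈L : P ∈ₗ L
    P∈L = argmin-all key (here refl) (All.tabulate there)

    P-minimal : ∀ {Q} → Q ∈ₗ L → key P ≤ key Q
    P-minimal (here refl) = f[argmin]≤f[⊤] {f = key} Q₀ Qs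
    P-minimal (there Q∈)  = All.lookup (f[argmin]≤f[xs] {f = key} Q₀ Qs) Q∈

    Unhit : List S
    Unhit = filter (¬? ∘ hits? P) L

    compatible-with-P : ∀ {Q} → Q ∈ₗ Unhit → Compatible P Q
    compatible-with-P Q∈ = let Q∈L , unhit = ∈-filter⁻ (¬? ∘ hits? P) Q∈ in
                           compatible-unless-hit (P-minimal Q∈L) unhit

    no-packing-of-unhit : ¬ Packing k Unhit
    no-packing-of-unhit (Ms , refl , Ms⊆ , pairwise) = no-packing
      ( P ∷ Ms , refl , P∈L ∷ All.map (proj₁ ∘ ∈-filter⁻ (¬? ∘ hits? P)) Ms⊆
      , All.map compatible-with-P Ms⊆ ∷ pairwise )

    hit : ∀ {Ps Q} → All (HitBy Ps) Unhit → Q ∈ₗ L → HitBy (P ∷ Ps) Q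
    hit {Q = Q} Ps-hit Q∈ with hits? P Q
    ... | yes P-hits = here P-hits
    ... | no unhit   = there (All.lookup Ps-hit (∈-filter⁺ (¬? ∘ hits? P) Q∈ unhit))

module _ {n : ℕ} (G : Graph n) where

  Adj-sym : ∀ {u v} → Adj G u v → Adj G v u
  Adj-sym {u} {v} = subst T (Graph.sym G u v)

  Adj-irrefl : ∀ {v} → ¬ Adj G v v
  Adj-irrefl {v} = subst T (Graph.irrefl G v)

  adj? : ∀ u v → Dec (Adj G u v)
  adj? u v = T? (Graph.adj G u v)

  IsPath : (Fin n → Set) → List (Fin n) → Set
  IsPath V p = Unique p × Linked (Adj G) p × All V p

  closed-path-is-cycle : ∀ {u v c} xs → Unique (u ∷ v ∷ xs ++ [ c ]) → Linked (Adj G) (u ∷ v ∷ xs ++ [ c ]) →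
                         Adj G c u → IsCycle G (λ _ → ⊤) (u ∷ v ∷ xs ++ [ c ])
  closed-path-is-cycle {u} {v} xs unique linked cu =
    s≤s (s≤s (≤-trans (m≤n+m 1 (length xs)) (≤-reflexive (sym (length-++ xs))))) ,
    unique , Linked-snoc (u ∷ v ∷ xs) linked cu , All.tabulate (λ _ → tt)

  IsCycle-weaken : ∀ {W} vs → IsCycle G W vs → IsCycle G (λ _ → ⊤) vs
  IsCycle-weaken (_ ∷ _) (long , unique , closed , _) = long , unique , closed , All.tabulate (λ _ → tt)

  Stable : Subset n → Set
  Stable Z = ∀ u v → u ∈ Z → v ∈ Z → ¬ Adj G u v

  IsPath-tail : ∀ {V v p} → IsPath V (v ∷ p) → IsPath V p
  IsPath-tail (_ ∷ unique , linked , _ ∷ inV) = unique , Linked.tail linked , inV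

  IsPath-prefix : ∀ {V} xs {c ys} → IsPath V (xs ++ c ∷ ys) → IsPath V (xs ++ [ c ])
  IsPath-prefix xs (unique , linked , inV) =
    AllPairs-prefix xs unique , Linked-prefix xs linked , All-prefix xs inV

  record IsRanking (V : Fin n → Set) (rank : Fin n → ℕ) : Set where
    field
      rank-≢        : ∀ {x y} → V x → V y → Adj G x y → rank x ≢ rank y
      parent-unique : ∀ {x u v} → V x → V u → V v → Adj G x u → Adj G x v →
                      rank x < rank u → rank x < rank v → u ≡ v

  IsRanking-restrict : ∀ {V V′ rank} → (∀ {u} → V u → V′ u) → IsRanking V′ rank → IsRanking V rank
  IsRanking-restrict V⊆V′ ranking = record
    { rank-≢        = λ x y → rank-≢ (V⊆V′ x) (V⊆V′ y)
    ; parent-unique = λ x u v → parent-unique (V⊆V′ x) (V⊆V′ u) (V⊆V′ v)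
    }
    where open IsRanking ranking

  insertBottom : Fin n → (Fin n → ℕ) → Fin n → ℕ
  insertBottom v rank u with u ≟ v
  ... | yes _ = 0
  ... | no  _ = suc (rank u)

  insertBottom-bottom : ∀ v rank → insertBottom v rank v ≡ 0
  insertBottom-bottom v rank with v ≟ v
  ... | yes _   = refl
  ... | no  v≢v = contradiction refl v≢v

  insertBottom-above : ∀ {v u} rank → u ≢ v → insertBottom v rank u ≡ suc (rank u)
  insertBottom-above {v} {u} rank u≢v with u ≟ v
  ... | yes u≡v = contradiction u≡v u≢v
  ... | no  _   = refl

  leaf-ranking : ∀ {R v rank} →
                 (∀ {a b} → a ∈ₗ R → b ∈ₗ R → Adj G v a → Adj G v b → a ≡ b) →
                 IsRanking (λ u → u ∈ₗ R × u ≢ v) rank →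
                 IsRanking (_∈ₗ R) (insertBottom v rank)
  leaf-ranking {R} {v} {rank} leaf ranking = record { rank-≢ = rank-≢′ ; parent-unique = parent-unique′ }
    where
    open IsRanking ranking
    ρ : Fin n → ℕ
    ρ = insertBottom v rank

    bottom : ρ v ≡ 0
    bottom = insertBottom-bottom v rank

    above : ∀ {u} → u ≢ v → ρ u ≡ suc (rank u)
    above = insertBottom-above rank

    rank-≢′ : ∀ {x y} → x ∈ₗ R → y ∈ₗ R → Adj G x y → ρ x ≢ ρ y
    rank-≢′ {x} {y} x∈ y∈ xy ρx≡ρy = by-cases (x ≟ v) (y ≟ v)
      where
      by-cases : Dec (x ≡ v) → Dec (y ≡ v) → ⊥
      by-cases (yes refl) (yes refl) = Adj-irrefl xy
      by-cases (yes refl) (no  y≢v)  = 0≢1+n (trans (sym bottom) (trans ρx≡ρy (above y≢v)))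
      by-cases (no  x≢v)  (yes refl) = 0≢1+n (trans (sym bottom) (trans (sym ρx≡ρy) (above x≢v)))
      by-cases (no  x≢v)  (no  y≢v)  =
        rank-≢ (x∈ , x≢v) (y∈ , y≢v) xy (suc-injective (trans (sym (above x≢v)) (trans ρx≡ρy (above y≢v))))

    above-bottom : ∀ {x u} → ρ x < ρ u → u ≢ v
    above-bottom {x} ρx<ρu refl = n≮0 (subst (ρ x <_) bottom ρx<ρu)

    parent-unique′ : ∀ {x u w} → x ∈ₗ R → u ∈ₗ R → w ∈ₗ R → Adj G x u → Adj G x w →
                     ρ x < ρ u → ρ x < ρ w → u ≡ w
    parent-unique′ {x} {u} {w} x∈ u∈ w∈ xu xw ρx<ρu ρx<ρw = by-cases (x ≟ v)
      where
      u≢v : u ≢ v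
      u≢v = above-bottom ρx<ρu
      w≢v : w ≢ v
      w≢v = above-bottom ρx<ρw
      by-cases : Dec (x ≡ v) → u ≡ w
      by-cases (yes refl) = leaf u∈ w∈ xu xw
      by-cases (no  x≢v)  =
        parent-unique (x∈ , x≢v) (u∈ , u≢v) (w∈ , w≢v) xu xw (lower ρx<ρu u≢v) (lower ρx<ρw w≢v)
        where
        lower : ∀ {y} → ρ x < ρ y → y ≢ v → rank x < rank y
        lower ρx<ρy y≢v = ≤-pred (subst₂ _<_ (above x≢v) (above y≢v) ρx<ρy)

module Forest {n : ℕ} (G : Graph n) (Z : Subset n) (hitting : CycleHitting G (λ _ → ⊤) (_∈ Z)) where

  open import Data.List.Membership.DecPropositional (_≟_ {n}) using () renaming (_∈?_ to _∈ₗ?_)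

  path-ends-nonadjacent : ∀ {u v c} xs → IsPath G (_∉ Z) (u ∷ v ∷ xs ++ [ c ]) → ¬ Adj G c u
  path-ends-nonadjacent xs (unique , linked , outside-Z) cu =
    All¬⇒¬Any outside-Z (hitting _ (closed-path-is-cycle G xs unique linked cu))

  Branching : List (Fin n) → Fin n → Set
  Branching R v = Any (λ a → Adj G v a × Any (λ b → Adj G v b × a ≢ b) R) R

  branching? : ∀ R v → Dec (Branching R v)
  branching? R v = Any.any? (λ a → adj? G v a ×-dec Any.any? (λ b → adj? G v b ×-dec ¬? (a ≟ b)) R) R

  non-branching-neighbours-equal : ∀ {R v a b} → ¬ Branching R v →
                                   a ∈ₗ R → b ∈ₗ R → Adj G v a → Adj G v b → a ≡ b
  non-branching-neighbours-equal {a = a} {b} not-branching a∈ b∈ va vb with a ≟ b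
  ... | yes a≡b = a≡b
  ... | no  a≢b = contradiction (lose a∈ (va , lose b∈ (vb , a≢b))) not-branching

  neighbour-avoiding : ∀ {R v} → Branching R v → ∀ w → ∃[ c ] c ∈ₗ R × Adj G v c × c ≢ w
  neighbour-avoiding branching w with find branching
  ... | a , a∈ , va , b-exists with find b-exists
  ...   | b , b∈ , vb , a≢b with a ≟ w
  ...     | yes refl = b , b∈ , vb , λ b≡a → a≢b (sym b≡a)
  ...     | no  a≢w  = a , a∈ , va , a≢w

  -- When every vertex of R has two neighbours in R, a path in R can always be extended without closing
  -- a cycle of the forest, until it has more than n vertices.
  module _ {R : List (Fin n)} (R-forest : All (_∉ Z) R) (all-branching : All (Branching R) R) where

    previous : Fin n → List (Fin n) → Fin n
    previous v []      = v
    previous v (w ∷ _) = w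

    in-forest : ∀ {p} → IsPath G (_∈ₗ R) p → IsPath G (_∉ Z) p
    in-forest (unique , linked , inR) = unique , linked , All.map (All.lookup R-forest) inR

    new-neighbour-off-path : ∀ {c v p} → IsPath G (_∈ₗ R) (v ∷ p) → Adj G v c → c ≢ previous v p → ¬ c ∈ₗ v ∷ p
    new-neighbour-off-path _ vc _ (here refl) = Adj-irrefl G vc
    new-neighbour-off-path {p = _ ∷ _} _ _ c≢w (there (here refl)) = c≢w refl
    new-neighbour-off-path {v = v} {p = w ∷ _} path vc _ (there (there c∈)) with ∈-∃++ c∈
    ... | xs , _ , refl = path-ends-nonadjacent xs (IsPath-prefix G (v ∷ w ∷ xs) (in-forest path)) (Adj-sym G vc)

    extend : ∀ {v p} → IsPath G (_∈ₗ R) (v ∷ p) → ∃[ c ] IsPath G (_∈ₗ R) (c ∷ v ∷ p)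
    extend {v} {p} path@(unique , linked , inR)
      with neighbour-avoiding (All.lookup all-branching (All.head inR)) (previous v p)
    ... | c , c∈R , vc , c≢prev with c ∈ₗ? v ∷ p
    ...   | yes c∈path = ⊥-elim (new-neighbour-off-path path vc c≢prev c∈path)
    ...   | no  c∉path = c , (¬Any⇒All¬ _ c∉path ∷ unique) , (Adj-sym G vc ∷ linked) , (c∈R ∷ inR)

    arbitrarily-long-path : ∀ {r} → r ∈ₗ R → ∀ k → ∃[ v ] ∃[ p ] IsPath G (_∈ₗ R) (v ∷ p) × length p ≡ k
    arbitrarily-long-path {r} r∈ zero = r , [] , (([] ∷ []) , [-] , (r∈ ∷ [])) , refl
    arbitrarily-long-path r∈ (suc k) with arbitrarily-long-path r∈ k
    ... | v , p , path , refl with extend path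
    ...   | c , path′ = c , v ∷ p , path′ , refl

  forest-has-leaf : ∀ {R r} → All (_∉ Z) R → r ∈ₗ R → ∃[ v ] v ∈ₗ R × ¬ Branching R v
  forest-has-leaf {R} R-forest r∈ with Any.any? (¬? ∘ branching? R) R
  ... | yes leaf-exists = find leaf-exists
  ... | no  no-leaf =
    let all-branching = All.map (decidable-stable (branching? R _)) (¬Any⇒All¬ R no-leaf)
        _ , _ , path , |p|≡n = arbitrarily-long-path R-forest all-branching r∈ n
    in  ⊥-elim (<-irrefl |p|≡n (Unique⇒length≤ (proj₁ path)))

  ranking-on : ∀ k R → length R ≤ k → All (_∉ Z) R → ∃ (IsRanking G (_∈ₗ R))
  ranking-on _       []       _            _        = (λ _ → 0) , record { rank-≢ = λ () ; parent-unique = λ () }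
  ranking-on (suc k) R@(_ ∷ _) |R|≤1+k R-forest with forest-has-leaf R-forest (here refl)
  ... | v , v∈R , leaf
    with ranking-on k (filter (¬? ∘ (_≟ v)) R) (<⇒≤pred (<-≤-trans (removing-member-shortens v∈R) |R|≤1+k))
                      (All.tabulate (λ u∈ → All.lookup R-forest (proj₁ (∈-filter⁻ (¬? ∘ (_≟ v)) u∈))))
  ...   | rank , ranking = insertBottom G v rank ,
          leaf-ranking G (non-branching-neighbours-equal leaf)
            (IsRanking-restrict G (λ (u∈ , u≢v) → ∈-filter⁺ (¬? ∘ (_≟ v)) u∈ u≢v) ranking)

  forest-ranking : ∃ (IsRanking G (_∉ Z))
  forest-ranking =
    let rank , ranking = ranking-on _ forest ≤-refl (All.tabulate (proj₂ ∘ ∈-filter⁻ (¬? ∘ (_∈? Z)) {xs = allFin n}))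
    in  rank , IsRanking-restrict G (λ u∉Z → ∈-filter⁺ (¬? ∘ (_∈? Z)) (∈-allFin _) u∉Z) ranking
    where
    forest : List (Fin n)
    forest = filter (¬? ∘ (_∈? Z)) (allFin n)

module Ascents {n : ℕ} (G : Graph n) (Z : Subset n) {rank : Fin n → ℕ}
               (ranking : IsRanking G (_∉ Z) rank) where

  open IsRanking ranking

  Parent : Fin n → Fin n → Set
  Parent x u = u ∉ Z × Adj G x u × rank x < rank u

  parent-unique′ : ∀ {x u v} → x ∉ Z → Parent x u → Parent x v → u ≡ v
  parent-unique′ x∉Z (u∉Z , xu , x<u) (v∉Z , xv , x<v) = parent-unique x∉Z u∉Z v∉Z xu xv x<u x<v

  parent? : ∀ x u → Dec (Parent x u)
  parent? x u = ¬? (u ∈? Z) ×-dec adj? G x u ×-dec rank x <? rank u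

  parentOrSelf : Fin n → Fin n
  parentOrSelf t with any? (parent? t)
  ... | yes (u , _) = u
  ... | no  _       = t

  parent≡parentOrSelf : ∀ {t u} → t ∉ Z → Parent t u → u ≡ parentOrSelf t
  parent≡parentOrSelf {t} {u} t∉Z t<u with any? (parent? t)
  ... | yes (_ , t<u′) = parent-unique′ t∉Z t<u t<u′
  ... | no  no-parent  = ⊥-elim (no-parent (u , t<u))

  parentOrSelf-∉ : ∀ {t} → t ∉ Z → parentOrSelf t ∉ Z
  parentOrSelf-∉ {t} t∉Z with any? (parent? t)
  ... | yes (_ , u∉Z , _) = u∉Z
  ... | no  _             = t∉Z

  data Ascent (C : Fin n → Set) : Fin n → Fin n → Set where
    []  : ∀ {x} → Ascent C x x
    up  : ∀ {x u y} → Parent x u → C u → Ascent C u y → Ascent C x y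

  Ascent-map : ∀ {C C′ x y} → (∀ {v} → C v → C′ v) → Ascent C x y → Ascent C′ x y
  Ascent-map f []              = []
  Ascent-map f (up x<u Cu asc) = up x<u (f Cu) (Ascent-map f asc)

  Ascent-snoc : ∀ {C x y u} → Ascent C x y → Parent y u → C u → Ascent C x u
  Ascent-snoc []               y<u Cu = up y<u Cu []
  Ascent-snoc (up x<v Cv asc) y<u Cu = up x<v Cv (Ascent-snoc asc y<u Cu)

  Ascent-rank≤ : ∀ {C x y} → Ascent C x y → rank x ≤ rank y
  Ascent-rank≤ []                           = ≤-refl
  Ascent-rank≤ (up (_ , _ , x<u) _ asc) = ≤-trans (<⇒≤ x<u) (Ascent-rank≤ asc)

  -- Parents are unique, so two ascents from x coincide as long as both continue.
  Ascent-lower-end : ∀ {C x t t′} → x ∉ Z → C x →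
                     Ascent (λ _ → ⊤) x t → Ascent C x t′ → rank t ≤ rank t′ → C t
  Ascent-lower-end x∉Z Cx [] _ _ = Cx
  Ascent-lower-end x∉Z Cx (up (_ , _ , x<u) _ asc) [] t≤x =
    ⊥-elim (<⇒≱ (<-≤-trans x<u (Ascent-rank≤ asc)) t≤x)
  Ascent-lower-end x∉Z Cx (up x<u _ asc) (up x<u′ Cu′ asc′) t≤t′
    with parent-unique′ x∉Z x<u x<u′
  ... | refl = Ascent-lower-end (proj₁ x<u) Cu′ asc asc′ t≤t′

  IsTop : List (Fin n) → Fin n → Set
  IsTop p t = t ∈ₗ p × (∀ {y} → y ∈ₗ p → rank y ≤ rank t)

  top-exists : ∀ v p → ∃ (IsTop (v ∷ p))
  top-exists v p = argmax rank v p , argmax-all rank {P = _∈ₗ v ∷ p} (here refl) (All.tabulate there) , below-top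
    where
    below-top : ∀ {y} → y ∈ₗ v ∷ p → rank y ≤ rank (argmax rank v p)
    below-top (here refl) = f[⊥]≤f[argmax] {f = rank} v p
    below-top (there y∈)  = All.lookup (f[xs]≤f[argmax] {f = rank} v p) y∈

  ForestPath : List (Fin n) → Set
  ForestPath = IsPath G (_∉ Z)

  descent-continues : ∀ {u w w′ r} → ForestPath (u ∷ w ∷ w′ ∷ r) → rank w < rank u → rank w′ < rank w
  descent-continues {u} {w} {w′} ((_ ∷ u≢w′ ∷ _) ∷ _ , uw ∷ ww′ ∷ _ , u∉Z ∷ w∉Z ∷ w′∉Z ∷ _) w<u
    with <-cmp (rank w′) (rank w)
  ... | tri< w′<w _ _ = w′<w
  ... | tri≈ _ w′≡w _ = ⊥-elim (rank-≢ w∉Z w′∉Z ww′ (sym w′≡w))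
  ... | tri> _ _ w<w′ = ⊥-elim (u≢w′ (parent-unique w∉Z u∉Z w′∉Z (Adj-sym G uw) ww′ w<u w<w′))

  descent-stays-below : ∀ {u w r y} → ForestPath (u ∷ w ∷ r) → rank w < rank u → y ∈ₗ w ∷ r → rank y < rank u
  descent-stays-below                 _    w<u (here refl) = w<u
  descent-stays-below {r = _ ∷ _} path w<u (there y∈)  =
    <-trans (descent-stays-below (IsPath-tail G path) (descent-continues path w<u) y∈) w<u

  descent-ascends-back : ∀ {u w r x} → ForestPath (u ∷ w ∷ r) → rank w < rank u →
                         x ∈ₗ w ∷ r → Ascent (_∈ₗ u ∷ w ∷ r) x u
  descent-ascends-back path@(_ , uw ∷ _ , u∉Z ∷ _) w<u (here refl) = up (u∉Z , Adj-sym G uw , w<u) (here refl) []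
  descent-ascends-back {r = _ ∷ _} path@(_ , uw ∷ _ , u∉Z ∷ _) w<u (there x∈) =
    Ascent-snoc (Ascent-map there (descent-ascends-back (IsPath-tail G path) (descent-continues path w<u) x∈))
                (u∉Z , Adj-sym G uw , w<u) (here refl)

  climbs-towards-top : ∀ {v w r t} → ForestPath (v ∷ w ∷ r) → IsTop (v ∷ w ∷ r) t → t ∈ₗ w ∷ r → rank v < rank w
  climbs-towards-top {v} {w} path@(_ , vw ∷ _ , v∉Z ∷ w∉Z ∷ _) (_ , max) t∈ with <-cmp (rank v) (rank w)
  ... | tri< v<w _ _ = v<w
  ... | tri≈ _ v≡w _ = ⊥-elim (rank-≢ v∉Z w∉Z vw v≡w)
  ... | tri> _ _ w<v = ⊥-elim (<⇒≱ (descent-stays-below path w<v t∈) (max (here refl)))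

  path-ascends-to-top : ∀ {p t x} → ForestPath p → IsTop p t → x ∈ₗ p → Ascent (_∈ₗ p) x t
  path-ascends-to-top {_ ∷ _}     _    (here refl , _) (here refl) = []
  path-ascends-to-top {_ ∷ _}     path (there t∈ , max) (there x∈) =
    Ascent-map there (path-ascends-to-top (IsPath-tail G path) (t∈ , max ∘ there) x∈)
  path-ascends-to-top {v ∷ w ∷ _} path@(_ , vw ∷ _ , v∉Z ∷ w∉Z ∷ _) (here refl , max) (there x∈) =
    descent-ascends-back path (≤∧≢⇒< (max (there (here refl))) (λ w≡v → rank-≢ v∉Z w∉Z vw (sym w≡v))) x∈
  path-ascends-to-top {v ∷ w ∷ _} path@(_ , vw ∷ _ , _ ∷ w∉Z ∷ _) top@(there t∈ , max) (here refl) =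
    up (w∉Z , vw , climbs-towards-top path top t∈) (there (here refl))
       (Ascent-map there (path-ascends-to-top (IsPath-tail G path) (t∈ , max ∘ there) (here refl)))

  parent-on-ascent : ∀ {x y t} → y ∉ Z → Parent y x → Ascent (λ _ → ⊤) y t → Ascent (λ _ → ⊤) x t ⊎ Parent t x
  parent-on-ascent _   y<x []               = inj₂ y<x
  parent-on-ascent y∉Z y<x (up y<u _ asc) with parent-unique′ y∉Z y<x y<u
  ... | refl = inj₁ asc

  touching-ascent : ∀ {x y t} → x ∉ Z → y ∉ Z → x ≡ y ⊎ Adj G x y →
                    Ascent (λ _ → ⊤) y t → Ascent (λ _ → ⊤) x t ⊎ Parent t x
  touching-ascent _ _ (inj₁ refl) asc = inj₁ asc
  touching-ascent {x} {y} x∉Z y∉Z (inj₂ xy) asc with <-cmp (rank x) (rank y)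
  ... | tri< x<y _ _ = inj₁ (up (y∉Z , xy , x<y) tt asc)
  ... | tri≈ _ x≡y _ = ⊥-elim (rank-≢ x∉Z y∉Z xy x≡y)
  ... | tri> _ _ y<x = parent-on-ascent y∉Z (x∉Z , Adj-sym G xy , y<x) asc

  touching-paths : ∀ {p q t t′ x y} → ForestPath p → ForestPath q → IsTop p t → IsTop q t′ → rank t ≤ rank t′ →
                   x ∈ₗ q → y ∈ₗ p → x ≡ y ⊎ Adj G x y → t ∈ₗ q ⊎ Parent t x
  touching-paths {x = x} path-p path-q top-p top-q t≤t′ x∈ y∈ touch =
    Sum.map₁ (λ asc → Ascent-lower-end x∉Z x∈ asc (path-ascends-to-top path-q top-q x∈) t≤t′)
             (touching-ascent x∉Z (All.lookup (proj₂ (proj₂ path-p)) y∈) touch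
                              (Ascent-map (λ _ → tt) (path-ascends-to-top path-p top-p y∈)))
    where
    x∉Z : x ∉ Z
    x∉Z = All.lookup (proj₂ (proj₂ path-q)) x∈

module SelfTransitions {n : ℕ} (G : Graph n) (Z : Subset n) where

  record SelfTransition : Set where
    constructor selfTransition
    field
      start            : Fin n
      interior         : List (Fin n)
      end              : Fin n
      isSelfTransition : IsSelfTransition G (λ _ → ⊤) (_∈ Z) start interior end

  open SelfTransition

  path : SelfTransition → List (Fin n)
  path S = start S ∷ interior S ++ [ end S ]

  foot : SelfTransition → Fin n
  foot S = proj₁ (proj₂ (isSelfTransition S))

  path-in-forest : ∀ S → IsPath G (_∉ Z) (path S)
  path-in-forest (selfTransition _ _ _ ((unique , linked , outside-Z , _) , _)) =
    unique , linked , All.map proj₂ outside-Z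

  foot∈Z : ∀ S → foot S ∈ Z
  foot∈Z (selfTransition _ _ _ (_ , _ , (z∈Z , _) , _)) = z∈Z

  foot-unique : ∀ S {v z} → v ∈ₗ path S → z ∈ Z → Adj G v z → z ≡ foot S
  foot-unique (selfTransition _ _ _ (_ , _ , _ , only-foot)) (here refl) z∈Z vz = only-foot _ (z∈Z , inj₁ vz)
  foot-unique (selfTransition _ mid _ ((_ , _ , outside-Z , _ , _ , interior∉N) , _ , _ , only-foot)) (there v∈) z∈Z vz
    with ∈-++⁻ mid v∈
  ... | inj₁ v∈mid       = ⊥-elim (All.lookup interior∉N v∈mid
                             (tt , proj₂ (All.lookup outside-Z (there (∈-++⁺ˡ v∈mid))) , _ , z∈Z , vz))
  ... | inj₂ (here refl) = only-foot _ (z∈Z , inj₂ vz)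

  start-adjacent-to-foot : ∀ S → Adj G (start S) (foot S)
  start-adjacent-to-foot S@(selfTransition _ _ _ ((_ , _ , _ , (_ , _ , z , z∈Z , az) , _) , _)) =
    subst (Adj G (start S)) (foot-unique S (here refl) z∈Z az) az

  end-adjacent-to-foot : ∀ S → Adj G (end S) (foot S)
  end-adjacent-to-foot S@(selfTransition _ mid _ ((_ , _ , _ , _ , (_ , _ , z , z∈Z , bz) , _) , _)) =
    subst (Adj G (end S)) (foot-unique S (there (∈-++⁺ʳ mid (here refl))) z∈Z bz) bz

  closingCycle : SelfTransition → List (Fin n)
  closingCycle S = foot S ∷ path S

  closingCycle-isCycle : ∀ S → IsCycle G (λ _ → ⊤) (closingCycle S)
  closingCycle-isCycle S =
    let unique , linked , outside-Z = path-in-forest S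
        foot∉path = All.map (λ v∉Z z≡v → v∉Z (subst (_∈ Z) z≡v (foot∈Z S))) outside-Z
    in  closed-path-is-cycle G (interior S) (foot∉path ∷ unique)
          (Adj-sym G (start-adjacent-to-foot S) ∷ linked) (end-adjacent-to-foot S)

  Compatible : SelfTransition → SelfTransition → Set
  Compatible S T = foot S ≢ foot T × Anticomplete G (path S) (path T)

  compatible⇒closingCycles-anticomplete : Stable G Z → ∀ {S T} →
                                          Compatible S T → Anticomplete G (closingCycle S) (closingCycle T)
  compatible⇒closingCycles-anticomplete Z-stable {S} {T} (feet≢ , _) (here refl) (here refl) =
    feet≢ , Z-stable _ _ (foot∈Z S) (foot∈Z T)
  compatible⇒closingCycles-anticomplete Z-stable {S} {T} (feet≢ , _) (here refl) (there y∈) =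
    (λ z≡y → All.lookup (proj₂ (proj₂ (path-in-forest T))) y∈ (subst (_∈ Z) z≡y (foot∈Z S))) ,
    (λ zy → feet≢ (foot-unique T y∈ (foot∈Z S) (Adj-sym G zy)))
  compatible⇒closingCycles-anticomplete Z-stable {S} {T} (feet≢ , _) (there x∈) (here refl) =
    (λ x≡z → All.lookup (proj₂ (proj₂ (path-in-forest S))) x∈ (subst (_∈ Z) (sym x≡z) (foot∈Z T))) ,
    (λ xz → feet≢ (sym (foot-unique S x∈ (foot∈Z T) xz)))
  compatible⇒closingCycles-anticomplete _ (_ , paths-anticomplete) (there x∈) (there y∈) = paths-anticomplete x∈ y∈

  inN? : ∀ v → Dec (InN G (λ _ → ⊤) (_∈ Z) v)
  inN? v = yes tt ×-dec ¬? (v ∈? Z) ×-dec any? (λ z → z ∈? Z ×-dec adj? G v z)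

  isSelfTransition? : ∀ a mid b → Dec (IsSelfTransition G (λ _ → ⊤) (_∈ Z) a mid b)
  isSelfTransition? a mid b =
    (AllPairs.allPairs? (λ x y → ¬? (x ≟ y)) p ×-dec Linked.linked? (adj? G) p ×-dec
     All.all? (λ v → yes tt ×-dec ¬? (v ∈? Z)) p ×-dec inN? a ×-dec inN? b ×-dec All.all? (¬? ∘ inN?) mid) ×-dec
    any? (λ z → isFoot? z ×-dec all? (λ z′ → isFoot? z′ →-dec z′ ≟ z))
    where
    p : List (Fin n)
    p = a ∷ mid ++ [ b ]
    isFoot? : ∀ z → Dec (IsFoot G (λ _ → ⊤) (_∈ Z) a b z)
    isFoot? z = z ∈? Z ×-dec (adj? G a z ⊎-dec adj? G b z)

  -- Proofs of IsSelfTransition need not be unique, so the enumeration is complete only up to ≈.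
  _≈_ : SelfTransition → SelfTransition → Set
  S ≈ T = foot S ≡ foot T × path S ≡ path T

  selfTransitionsAmong : List (Fin n × List (Fin n) × Fin n) → List SelfTransition
  selfTransitionsAmong []                  = []
  selfTransitionsAmong ((a , mid , b) ∷ ts) with isSelfTransition? a mid b
  ... | yes st = selfTransition a mid b st ∷ selfTransitionsAmong ts
  ... | no  _  = selfTransitionsAmong ts

  ∈-selfTransitionsAmong : ∀ {ts} S → (start S , interior S , end S) ∈ₗ ts → Any (_≈ S) (selfTransitionsAmong ts)
  ∈-selfTransitionsAmong S (here refl) with isSelfTransition? (start S) (interior S) (end S)
  ... | yes (_ , _ , is-foot , _) = here (proj₂ (proj₂ (proj₂ (isSelfTransition S))) _ is-foot , refl)
  ... | no  ¬st                   = ⊥-elim (¬st (isSelfTransition S))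
  ∈-selfTransitionsAmong {(a , mid , b) ∷ _} S (there t∈) with isSelfTransition? a mid b
  ... | yes _ = there (∈-selfTransitionsAmong S t∈)
  ... | no  _ = ∈-selfTransitionsAmong S t∈

  selfTransitions : List SelfTransition
  selfTransitions = selfTransitionsAmong
    (cartesianProduct (allFin n) (cartesianProduct (boundedLists (allFin n) n) (allFin n)))

  selfTransitions-complete : ∀ S → Any (_≈ S) selfTransitions
  selfTransitions-complete S = ∈-selfTransitionsAmong S
    (∈-cartesianProduct⁺ (∈-allFin _)
      (∈-cartesianProduct⁺ (∈-boundedLists n (All.tabulate (λ _ → ∈-allFin _)) interior-length≤n) (∈-allFin _)))
    where
    mid : List (Fin n)
    mid = interior S
    interior-length≤n : length mid ≤ n
    interior-length≤n = ≤-trans (≤-trans (m≤m+n (length mid) 1) (≤-reflexive (sym (length-++ mid))))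
                                (≤-trans (n≤1+n _) (Unique⇒length≤ (proj₁ (path-in-forest S))))

module Covering {n : ℕ} (G : Graph n) (Z : Subset n) {rank : Fin n → ℕ} (ranking : IsRanking G (_∉ Z) rank) where

  open SelfTransitions G Z
  open SelfTransition
  open Ascents G Z ranking

  top : SelfTransition → Fin n
  top S = proj₁ (top-exists (start S) (interior S ++ [ end S ]))

  top-isTop : ∀ S → IsTop (path S) (top S)
  top-isTop S = proj₂ (top-exists (start S) (interior S ++ [ end S ]))

  top∉Z : ∀ S → top S ∉ Z
  top∉Z S = All.lookup (proj₂ (proj₂ (path-in-forest S))) (proj₁ (top-isTop S))

  -- Deleting the top of P and its parent separates P from every self-transition whose top is at least as high.
  hitSet : SelfTransition → Subset n
  hitSet S = ⁅ top S ⁆ ∪ ⁅ parentOrSelf (top S) ⁆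

  ∣hitSet∣≤2 : ∀ S → ∣ hitSet S ∣ ≤ 2
  ∣hitSet∣≤2 S = ≤-trans (∣p∪q∣≤∣p∣+∣q∣ ⁅ top S ⁆ _)
                         (≤-reflexive (cong₂ _+_ (∣⁅x⁆∣≡1 (top S)) (∣⁅x⁆∣≡1 (parentOrSelf (top S)))))

  hitSet⊆∁Z : ∀ S → hitSet S ⊆ ∁ Z
  hitSet⊆∁Z S v∈ = x∉p⇒x∈∁p
    ([ (λ v∈top → subst (_∉ Z) (sym (x∈⁅y⁆⇒x≡y _ v∈top)) (top∉Z S))
     , (λ v∈parent → subst (_∉ Z) (sym (x∈⁅y⁆⇒x≡y _ v∈parent)) (parentOrSelf-∉ (top∉Z S))) ]′
     (x∈p∪q⁻ _ _ v∈))

  Hits : SelfTransition → SelfTransition → Set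
  Hits P Q = foot Q ≡ foot P ⊎ Any (_∈ hitSet P) (path Q)

  hits? : ∀ P Q → Dec (Hits P Q)
  hits? P Q = foot Q ≟ foot P ⊎-dec Any.any? (_∈? hitSet P) (path Q)

  compatible-unless-hit : ∀ {P Q} → rank (top P) ≤ rank (top Q) → ¬ Hits P Q → Compatible P Q
  compatible-unless-hit {P} {Q} P≤Q unhit = (λ feet≡ → unhit (inj₁ (sym feet≡))) , anticomplete
    where
    meets-hitSet : ∀ {x} → x ∈ₗ path Q → top P ∈ₗ path Q ⊎ Parent (top P) x → Any (_∈ hitSet P) (path Q)
    meets-hitSet _  (inj₁ top∈)  =
      Any.map (λ top≡v → subst (_∈ hitSet P) top≡v (x∈p∪q⁺ (inj₁ (x∈⁅x⁆ _)))) top∈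
    meets-hitSet x∈ (inj₂ top<x) =
      lose x∈ (x∈p∪q⁺ (inj₂ (subst (λ u → _ ∈ ⁅ u ⁆) (parent≡parentOrSelf (top∉Z P) top<x) (x∈⁅x⁆ _))))

    touching : ∀ {x y} → x ∈ₗ path P → y ∈ₗ path Q → y ≡ x ⊎ Adj G y x → Any (_∈ hitSet P) (path Q)
    touching x∈ y∈ touch = meets-hitSet y∈
      (touching-paths (path-in-forest P) (path-in-forest Q) (top-isTop P) (top-isTop Q) P≤Q y∈ x∈ touch)

    anticomplete : Anticomplete G (path P) (path Q)
    anticomplete x∈ y∈ = (λ x≡y → unhit (inj₂ (touching x∈ y∈ (inj₁ (sym x≡y)))))
                       , (λ xy → unhit (inj₂ (touching x∈ y∈ (inj₂ (Adj-sym G xy)))))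

  open GreedyCover (rank ∘ top) Compatible Hits hits? (λ {P} {Q} → compatible-unless-hit {P} {Q})

  no-large-packing : ∀ {s} → SOFree G s (λ _ → ⊤) → Stable G Z →
                     ∀ L → ¬ Packing s L
  no-large-packing sO-free Z-stable L (Ms , |Ms|≡s , _ , pairwise) = sO-free
    ( map closingCycle Ms , trans (length-map closingCycle Ms) |Ms|≡s
    , All.map⁺ (All.tabulate (λ {S} _ → closingCycle-isCycle S))
    , AllPairs.map⁺ (AllPairs.map (λ {S} {T} → compatible⇒closingCycles-anticomplete Z-stable {S} {T}) pairwise) )

  module _ (Ps : List SelfTransition) where

    feet : Subset n
    feet = ⋃ (map (⁅_⁆ ∘ foot) Ps)

    hitSets : Subset n
    hitSets = ⋃ (map hitSet Ps)

    ∣feet∣≤ : ∣ feet ∣ ≤ length Ps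
    ∣feet∣≤ = ≤-trans (∣⋃∣≤ (map (⁅_⁆ ∘ foot) Ps) (All.map⁺ (All.tabulate (λ {P} _ → ≤-reflexive (∣⁅x⁆∣≡1 (foot P))))))
                      (≤-reflexive (trans (*-identityˡ _) (length-map _ Ps)))

    ∣hitSets∣≤ : ∣ hitSets ∣ ≤ 2 * length Ps
    ∣hitSets∣≤ = ≤-trans (∣⋃∣≤ (map hitSet Ps) (All.map⁺ (All.tabulate (λ {P} _ → ∣hitSet∣≤2 P))))
                         (≤-reflexive (cong (2 *_) (length-map _ Ps)))

    feet⊆Z : feet ⊆ Z
    feet⊆Z v∈ = let P , v∈⁅foot⁆ = Any.satisfied (Any.map⁻ (x∈⋃⁻ (map (⁅_⁆ ∘ foot) Ps) v∈))
                in  subst (_∈ Z) (sym (x∈⁅y⁆⇒x≡y _ v∈⁅foot⁆)) (foot∈Z P)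

    hitSets⊆∁Z : hitSets ⊆ ∁ Z
    hitSets⊆∁Z v∈ = let P , v∈hitSet = Any.satisfied (Any.map⁻ (x∈⋃⁻ (map hitSet Ps) v∈))
                    in  hitSet⊆∁Z P v∈hitSet

    hit⇒covered : ∀ {S S′} → S′ ≈ S → HitBy Ps S′ → foot S ∈ feet ⊎ Any (_∈ hitSets) (path S)
    hit⇒covered {S} (feet≡ , paths≡) hit with find hit
    ... | P , P∈ , inj₁ foot≡ =
      let S-foot∈ = subst (_∈ ⁅ foot P ⁆) (trans (sym foot≡) feet≡) (x∈⁅x⁆ (foot P))
      in  inj₁ (x∈⋃⁺ (map (⁅_⁆ ∘ foot) Ps) (Any.map⁺ (lose P∈ S-foot∈)))
    ... | P , P∈ , inj₂ meets =
      inj₂ (Any.map (λ v∈ → x∈⋃⁺ (map hitSet Ps) (Any.map⁺ (lose P∈ v∈))) (subst (Any (_∈ hitSet P)) paths≡ meets))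

  self-transitions-coverable :
    ∀ {s} → SOFree G s (λ _ → ⊤) → Stable G Z →
    ∃[ X ] ∃[ Y ] (X ⊆ Z × Y ⊆ ∁ Z × ∣ X ∣ < s × ∣ Y ∣ < 2 * s ×
                   (∀ S → foot S ∈ X ⊎ Any (_∈ Y) (path S)))
  self-transitions-coverable {s} sO-free Z-stable =
    let Ps , |Ps|<s , all-hit = greedy-cover s selfTransitions (no-large-packing sO-free Z-stable selfTransitions)
    in  feet Ps , hitSets Ps , feet⊆Z Ps , hitSets⊆∁Z Ps ,
        ≤-<-trans (∣feet∣≤ Ps) |Ps|<s , ≤-<-trans (∣hitSets∣≤ Ps) (*-monoʳ-< 2 |Ps|<s) ,
        λ S → let S′ , S′∈ , S′≈S = find (selfTransitions-complete S)
              in  hit⇒covered Ps {S} {S′} S′≈S (All.lookup all-hit S′∈)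

module AfterOperations {n : ℕ} (G : Graph n) (Z X Y : Subset n) where

  open SelfTransitions G Z using (SelfTransition; selfTransition; foot; path)

  W : Fin n → Set
  W = AfterOps G Z X Y

  Z′ : Fin n → Set
  Z′ = ZAfter G Z X

  afterOps-plantation : ∀ {s} → Y ⊆ ∁ Z → Plantation G s (λ _ → ⊤) (_∈ Z) → Plantation G s W Z′
  afterOps-plantation Y⊆∁Z (sO-free , _ , hitting) =
    (λ (cs , |cs|≡s , cycles , pairwise) → sO-free (cs , |cs|≡s , All.map (IsCycle-weaken G _) cycles , pairwise)) ,
    (λ v (v∈Z , v∉X) → v∉X , (λ v∉Z → ⊥-elim (v∉Z v∈Z)) , (λ v∈Y → x∈∁p⇒x∉p (Y⊆∁Z v∈Y) v∈Z)) ,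
    λ { vs@(_ ∷ _) cycle@(_ , _ , _ , inW) →
          let v , v∈ , v∈Z = find (hitting vs (IsCycle-weaken G vs cycle))
          in  lose v∈ (v∈Z , proj₁ (All.lookup inW v∈)) }

  Z-neighbour-survives : ∀ {v z} → W v → v ∉ Z → z ∈ Z → Adj G v z → Z′ z
  Z-neighbour-survives (_ , not-adjacent-to-X , _) v∉Z z∈Z vz = z∈Z , λ z∈X → not-adjacent-to-X v∉Z _ z∈X vz

  N′⊆N : ∀ {v} → InN G W Z′ v → InN G (λ _ → ⊤) (_∈ Z) v
  N′⊆N (v∈W , v∉Z′ , z , z∈Z′ , vz) = tt , (λ v∈Z → v∉Z′ (v∈Z , proj₁ v∈W)) , z , proj₁ z∈Z′ , vz

  N∩W⊆N′ : ∀ {v} → W v → InN G (λ _ → ⊤) (_∈ Z) v → InN G W Z′ v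
  N∩W⊆N′ v∈W (_ , v∉Z , z , z∈Z , vz) = v∈W , (λ v∈Z′ → v∉Z (proj₁ v∈Z′)) , z , Z-neighbour-survives v∈W v∉Z z∈Z vz , vz

  lift-selfTransition : ∀ {a mid b} → IsSelfTransition G W Z′ a mid b → SelfTransition
  lift-selfTransition {a} {mid} {b}
    ((unique , linked , inW , a∈N′ , b∈N′ , mid∉N′) , z , (z∈Z′ , z-adjacent) , only-foot) =
    selfTransition a mid b
      ((unique , linked , outside-Z , N′⊆N a∈N′ , N′⊆N b∈N′ , mid∉N) , z , (proj₁ z∈Z′ , z-adjacent) , only-foot′)
    where
    outside-Z : All (λ v → ⊤ × v ∉ Z) (a ∷ mid ++ [ b ])
    outside-Z = All.map (λ (v∈W , v∉Z′) → tt , λ v∈Z → v∉Z′ (v∈Z , proj₁ v∈W)) inW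
    mid∉N : All (λ v → ¬ InN G (λ _ → ⊤) (_∈ Z) v) mid
    mid∉N = All.tabulate λ v∈mid v∈N →
      All.lookup mid∉N′ v∈mid (N∩W⊆N′ (proj₁ (All.lookup inW (there (∈-++⁺ˡ v∈mid)))) v∈N)
    survives : ∀ {v z′} → InN G W Z′ v → z′ ∈ Z → Adj G v z′ → Z′ z′
    survives v∈N′ = Z-neighbour-survives (proj₁ v∈N′) (proj₁ (proj₂ (N′⊆N v∈N′)))
    only-foot′ : ∀ z′ → IsFoot G (λ _ → ⊤) (_∈ Z) a b z′ → z′ ≡ z
    only-foot′ z′ (z′∈Z , inj₁ az′) = only-foot z′ (survives a∈N′ z′∈Z az′ , inj₁ az′)
    only-foot′ z′ (z′∈Z , inj₂ bz′) = only-foot z′ (survives b∈N′ z′∈Z bz′ , inj₂ bz′)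

  afterOps-selfless : (∀ S → foot S ∈ X ⊎ Any (_∈ Y) (path S)) → Selfless G W Z′
  afterOps-selfless covered (_ , _ , _ , st@((_ , _ , inW , _) , _ , (z∈Z′ , _) , _))
    with covered (lift-selfTransition st)
  ... | inj₁ z∈X   = proj₂ z∈Z′ z∈X
  ... | inj₂ meets = let _ , v∈ , v∈Y = find meets in proj₂ (proj₂ (proj₁ (All.lookup inW v∈))) v∈Y

mainTheorem9 : (s : ℕ) → 1 ≤ s → {n : ℕ} → (G : Graph n) → (Z : Subset n) →
    Plantation G s (λ _ → ⊤) (_∈ Z) →
    Monic G Z →
    ∃[ X ] ∃[ Y ] (X ⊆ Z × Y ⊆ ∁ Z × ∣ X ∣ < s × ∣ Y ∣ < 2 * s * s ! ×
    Plantation G s (AfterOps G Z X Y) (ZAfter G Z X) ×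
    Selfless G (AfterOps G Z X Y) (ZAfter G Z X))
mainTheorem9 s _ G Z plantation@(sO-free , _ , hitting) (Z-stable , _) =
  let _ , ranking = Forest.forest-ranking G Z hitting
      X , Y , X⊆Z , Y⊆∁Z , |X|<s , |Y|<2s , covered = Covering.self-transitions-coverable G Z ranking sO-free Z-stable
      open AfterOperations G Z X Y
  in  X , Y , X⊆Z , Y⊆∁Z , |X|<s , <-≤-trans |Y|<2s (m≤m*n (2 * s) (s !) {{s !≢0}}) ,
      afterOps-plantation Y⊆∁Z plantation , afterOps-selfless covered
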